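{- Let $G$ be a graph with vertex set $V$ and let $W\subseteq V$ be reducible in $G$. Then $\mathrm{rank}(G)=\mathrm{rank}_G(W)+\mathrm{rank}(\Gamma_W(G))$.
   Context: A graph is a finite graph with vertex set $V$, no multiple edges, in which each vertex may or may not carry a loop. Its adjacency matrix $A$ is the symmetric $V\times V$ matrix over $\mathbf{F}_2$ with $A_{vw}=1$ iff $v\ne w$ are adjacent and $A_{vv}=1$ iff $v$ has a loop. $\mathrm{rank}_G(W)$ is the $\mathbf{F}_2$-rank of the principal submatrix of $A$ on rows and columns $W$; $\mathrm{rank}(H)$ is the $\mathbf{F}_2$-rank of the full adjacency matrix of a graph $H$. Let $\mathcal{V}$ be the $\mathbf{F}_2$-vector space with basis $V$, $\mathcal{E}(x,y)=x^TAy$, $\langle W\rangle$ the span of $W$, $\langle W\rangle^{\perp}=\{x:\mathcal{E}(x,w)=0\ \forall w\in\langle W\rangle\}$. $W$ is reducible in $G$ if $\langle W\rangle+\langle W\rangle^{\perp}=\mathcal{V}$. For reducible $W$, $\Gamma_W(G)$ is the graph on $V\setminus W$ in which $v,w\in V\setminus W$ (possibly $v=w$, concerning a loop) are adjacent iff $\mathcal{E}(v',w')=1$, where $v',w'\in\langle W\rangle^{\perp}$ are any vectors with $v-v',w-w'\in\langle W\rangle$ (independent of the choice). -}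

module Defs where

open import Data.Nat using (ℕ; zero; suc; _⊔_)
open import Data.Bool using (Bool; true; false; _∧_; _∨_; _xor_; not; if_then_else_)
open import Data.Fin using (Fin; zero; suc; _≟_)
open import Data.Fin.Subset using (Subset; ∣_∣; ⊤; ∁)
open import Data.Vec using (Vec; []; _∷_; lookup)
open import Data.List using (List; []; _∷_; map; filter; foldr; _++_)
open import Data.Product using (Σ; _×_; _,_)
open import Relation.Binary.PropositionalEquality using (_≡_)
open import Relation.Nullary.Decidable using (⌊_⌋)
open import Relation.Nullary using (¬_)

-- A (looped) graph on vertex set V = Fin n, given by its symmetric
-- adjacency matrix over F₂ (Bool, with xor as addition, ∧ as product).
-- adj v v ≡ true iff v carries a loop.
record Graph (n : ℕ) : Set where
  field
    adj : Fin n → Fin n → Bool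
    sym : ∀ v w → adj v w ≡ adj w v
open Graph public

Vect : ℕ → Set
Vect n = Fin n → Bool

sumF : ∀ {n} → (Fin n → Bool) → Bool
sumF {zero}  f = false
sumF {suc n} f = f zero xor sumF (λ i → f (suc i))

_+ᵥ_ : ∀ {n} → Vect n → Vect n → Vect n
(x +ᵥ y) i = x i xor y i

basis : ∀ {n} → Fin n → Vect n
basis v i = ⌊ v ≟ i ⌋

ℰ : ∀ {n} → (Fin n → Fin n → Bool) → Vect n → Vect n → Bool
ℰ A x y = sumF (λ i → x i ∧ sumF (λ j → A i j ∧ y j))

_∈ᵇ_ : ∀ {n} → Fin n → Subset n → Bool
i ∈ᵇ S = lookup S i

-- x ∈ ⟨W⟩ : x is a linear combination of the basis vectors in W,
-- i.e. its support is contained in W.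
InSpan : ∀ {n} → Subset n → Vect n → Set
InSpan W x = ∀ i → i ∈ᵇ W ≡ false → x i ≡ false

InPerp : ∀ {n} → Graph n → Subset n → Vect n → Set
InPerp G W x = ∀ y → InSpan W y → ℰ (adj G) x y ≡ false

Reducible : ∀ {n} → Graph n → Subset n → Set
Reducible {n} G W = ∀ (z : Vect n) → Σ (Vect _) λ a → Σ (Vect _) λ b →
  InSpan W a × InPerp G W b × (∀ i → z i ≡ (a +ᵥ b) i)

-- B restricted to the vertices V ∖ W is the adjacency matrix of Γ_W(G):
-- for v, w ∉ W (possibly v = w), B v w = ℰ(v', w') for every
-- v', w' ∈ ⟨W⟩^⊥ with v - v', w - w' ∈ ⟨W⟩.
-- (Entries of B with an index in W are irrelevant.)
IsGamma : ∀ {n} → Graph n → Subset n → (Fin n → Fin n → Bool) → Set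
IsGamma {n} G W B = ∀ (v w : Fin n) → v ∈ᵇ W ≡ false → w ∈ᵇ W ≡ false →
  ∀ (v' w' : Vect n) → InPerp G W v' → InPerp G W w' →
  InSpan W (basis v +ᵥ v') → InSpan W (basis w +ᵥ w') →
  B v w ≡ ℰ (adj G) v' w'

-- F₂-rank of a principal submatrix, defined as the maximal number of
-- linearly independent rows (by exhaustive enumeration).

subsets : (n : ℕ) → List (Subset n)
subsets zero    = [] ∷ []
subsets (suc n) = map (true ∷_) (subsets n) ++ map (false ∷_) (subsets n)

anyF : ∀ {n} → (Fin n → Bool) → Bool
anyF {zero}  f = false
anyF {suc n} f = f zero ∨ anyF (λ i → f (suc i))

allF : ∀ {n} → (Fin n → Bool) → Bool
allF f = not (anyF (λ i → not (f i)))

_⊆ᵇ_ : ∀ {n} → Subset n → Subset n → Bool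
U ⊆ᵇ T = allF (λ i → not (i ∈ᵇ U) ∨ (i ∈ᵇ T))

nonempty : ∀ {n} → Subset n → Bool
nonempty U = anyF (λ i → i ∈ᵇ U)

rowSum : ∀ {n} → (Fin n → Fin n → Bool) → Subset n → Subset n → Vect n
rowSum M S U j = (j ∈ᵇ S) ∧ sumF (λ i → (i ∈ᵇ U) ∧ M i j)

independent : ∀ {n} → (Fin n → Fin n → Bool) → Subset n → Subset n → Bool
independent {n} M S T =
  not (anyListF (λ U → (U ⊆ᵇ T) ∧ nonempty U ∧ not (anyF (rowSum M S U))) (subsets n))
  where
  anyListF : (Subset n → Bool) → List (Subset n) → Bool
  anyListF p = foldr (λ U b → p U ∨ b) false

rankOn : ∀ {n} → (Fin n → Fin n → Bool) → Subset n → ℕ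
rankOn {n} M S =
  foldr (λ T r → (if (T ⊆ᵇ S) ∧ independent M S T then ∣ T ∣ else 0) ⊔ r) 0 (subsets n)

rankG : ∀ {n} → Graph n → Subset n → ℕ
rankG G W = rankOn (adj G) W

rank : ∀ {n} → Graph n → ℕ
rank G = rankOn (adj G) ⊤

module Submission where

-- The dimension-theoretic input is the Steinitz exchange
-- lemma (independent vectors in the span of |R| generators number at most
-- |R|), together with a decoding of the enumerative rankOn: a largest
-- independent set of rows exists, bounds all others, and spans the rest.
--
-- For reducible W write e_i = a_i + b_i, a_i ∈ ⟨W⟩, b_i ∈ ⟨W⟩^⊥; then
-- Γ_vw = ℰ(b_v, b_w) for v, w ∉ W, and ⟨W⟩ ∩ ⟨W⟩^⊥ lies in the radical of ℰ.
-- Let T₀, T₁ be row bases of A[W] and Γ[V∖W], and R = T₀ ∪ T₁ (disjoint).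
-- Lower bound: the rows of A indexed by R are independent.  Upper bound:
-- every row of A is a combination of the A_u (u ∈ T₀) and A b_u (u ∈ T₁),
-- so by exchange rank G ≤ |R|.

open import Defs renaming (sym to adj-sym)

open import Algebra.Bundles using (CommutativeRing)
open import Data.Nat using (ℕ; zero; suc; _+_; _≤_; _⊔_; s≤s)
open import Data.Nat.Properties
  using (≤-antisym; ≤-trans; ≤-reflexive; m≤m⊔n; m≤n⊔m; ⊔-sel; +-comm; suc-injective;
         m≤n⇒m≤1+n; n≮n; m+n≡0⇒m≡0; m+n≡0⇒n≡0; +-commutativeSemigroup; module ≤-Reasoning)
open import Data.Bool using (Bool; true; false; _∧_; _∨_; _xor_; not; if_then_else_)
open import Data.Bool.Properties
  using (∧-comm; ∧-assoc; ∧-zeroʳ; ∧-identityʳ; ∨-zeroʳ; ∨-identityʳ; ∧-distribˡ-xor;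
         ∧-distribʳ-xor; xor-assoc; xor-same; xor-identityʳ; ¬-not; xor-∧-commutativeRing)
open import Data.Fin using (Fin; zero; suc; _≟_)
open import Data.Fin.Subset using (Subset; ∁; ⊤; ∣_∣)
open import Data.Vec using ([]; _∷_; lookup; tabulate)
open import Data.Vec.Properties using (lookup∘tabulate; lookup-map; lookup-replicate)
open import Data.List using (List; []; _∷_; foldr; map)
open import Data.List.Membership.Propositional using (_∈_)
open import Data.List.Membership.Propositional.Properties using (∈-++⁺ˡ; ∈-++⁺ʳ; ∈-map⁺)
open import Data.List.Relation.Unary.Any using (here; there)
open import Data.Product using (Σ; _×_; _,_; proj₁; proj₂)
open import Data.Sum using (_⊎_; inj₁; inj₂)
open import Data.Empty using (⊥-elim)
open import Relation.Nullary using (yes; no)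
open import Relation.Binary.PropositionalEquality

open import Algebra.Properties.CommutativeSemigroup
  (CommutativeRing.+-commutativeSemigroup xor-∧-commutativeRing)
  using () renaming (interchange to xor-interchange)
open import Algebra.Properties.CommutativeSemigroup +-commutativeSemigroup
  using () renaming (interchange to +-interchange)

∧-true⁻ : ∀ {a b} → a ∧ b ≡ true → a ≡ true × b ≡ true
∧-true⁻ {true} {true} _ = refl , refl

∨-true⁻ : ∀ {a b} → a ∨ b ≡ true → a ≡ true ⊎ b ≡ true
∨-true⁻ {true}  _ = inj₁ refl
∨-true⁻ {false} p = inj₂ p

∨-false⁻ : ∀ {a b} → a ∨ b ≡ false → a ≡ false × b ≡ false
∨-false⁻ {false} {false} _ = refl , refl

xor-true⁻ : ∀ {a b} → a xor b ≡ true → a ≡ true ⊎ b ≡ true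
xor-true⁻ {true}  _ = inj₁ refl
xor-true⁻ {false} p = inj₂ p

xor-false⁻ : ∀ {a b} → a xor b ≡ false → a ≡ b
xor-false⁻ {false} {false} _ = refl
xor-false⁻ {true}  {true}  _ = refl

false≢true : false ≢ true
false≢true ()

contraposeᵇ : ∀ {a b} → (a ≡ false → b ≡ false) → b ≡ true → a ≡ true
contraposeᵇ {true}  _ _  = refl
contraposeᵇ {false} h bt = ⊥-elim (false≢true (trans (sym (h refl)) bt))

not-true⁻ : ∀ {a} → not a ≡ true → a ≡ false
not-true⁻ {false} _ = refl

not-false⁻ : ∀ {a} → not a ≡ false → a ≡ true
not-false⁻ {true} _ = refl

xor-cancelˡ : ∀ a b → a xor (a xor b) ≡ b
xor-cancelˡ a b = trans (sym (xor-assoc a a b)) (cong (_xor b) (xor-same a))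

xor-cancelʳ : ∀ a b → (a xor b) xor b ≡ a
xor-cancelʳ a b = trans (xor-assoc a b b) (trans (cong (a xor_) (xor-same b)) (xor-identityʳ a))

basis-refl : ∀ {n} (v : Fin n) → basis v v ≡ true
basis-refl v with v ≟ v
... | yes _  = refl
... | no v≢v = ⊥-elim (v≢v refl)

basis-true : ∀ {n} {v i : Fin n} → basis v i ≡ true → v ≡ i
basis-true {v = v} {i} p with v ≟ i
... | yes v≡i = v≡i
basis-true {v = v} {i} () | no _

basis-false : ∀ {n} {v i : Fin n} → v ≢ i → basis v i ≡ false
basis-false {v = v} {i} v≢i with v ≟ i
... | yes v≡i = ⊥-elim (v≢i v≡i)
... | no _    = refl

basis-sym : ∀ {n} (v i : Fin n) → basis v i ≡ basis i v
basis-sym v i with v ≟ i | i ≟ v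
... | yes _   | yes _   = refl
... | no _    | no _    = refl
... | yes v≡i | no i≢v  = ⊥-elim (i≢v (sym v≡i))
... | no v≢i  | yes i≡v = ⊥-elim (v≢i (sym i≡v))

basis-suc : ∀ {n} (v i : Fin n) → basis (suc v) (suc i) ≡ basis v i
basis-suc v i with v ≟ i
... | yes _ = refl
... | no _  = refl

sumF-cong : ∀ {n} {f g : Vect n} → (∀ i → f i ≡ g i) → sumF f ≡ sumF g
sumF-cong {zero}  _ = refl
sumF-cong {suc n} h = cong₂ _xor_ (h zero) (sumF-cong (λ i → h (suc i)))

sumF-zero : ∀ {n} {f : Vect n} → (∀ i → f i ≡ false) → sumF f ≡ false
sumF-zero {zero}  _ = refl
sumF-zero {suc n} h = cong₂ _xor_ (h zero) (sumF-zero (λ i → h (suc i)))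

sumF-false : ∀ {n} → sumF {n} (λ _ → false) ≡ false
sumF-false {n} = sumF-zero {n} (λ _ → refl)

sumF-xor : ∀ {n} (f g : Vect n) → sumF (f +ᵥ g) ≡ sumF f xor sumF g
sumF-xor {zero}  _ _ = refl
sumF-xor {suc n} f g =
  trans (cong ((f zero xor g zero) xor_) (sumF-xor (λ i → f (suc i)) (λ i → g (suc i))))
        (xor-interchange (f zero) (g zero) _ _)

sumF-scaleˡ : ∀ {n} b (f : Vect n) → sumF (λ i → b ∧ f i) ≡ b ∧ sumF f
sumF-scaleˡ {zero}  b _ = sym (∧-zeroʳ b)
sumF-scaleˡ {suc n} b f =
  trans (cong ((b ∧ f zero) xor_) (sumF-scaleˡ b (λ i → f (suc i))))
        (sym (∧-distribˡ-xor b (f zero) _))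

sumF-scaleʳ : ∀ {n} b (f : Vect n) → sumF (λ i → f i ∧ b) ≡ sumF f ∧ b
sumF-scaleʳ {zero}  b _ = refl
sumF-scaleʳ {suc n} b f =
  trans (cong ((f zero ∧ b) xor_) (sumF-scaleʳ b (λ i → f (suc i))))
        (sym (∧-distribʳ-xor b (f zero) _))

sumF-swap : ∀ {m n} (f : Fin m → Fin n → Bool) →
  sumF (λ i → sumF (f i)) ≡ sumF (λ j → sumF (λ i → f i j))
sumF-swap {zero} {n} _ = sym (sumF-false {n})
sumF-swap {suc m} f =
  trans (cong (sumF (f zero) xor_) (sumF-swap (λ i → f (suc i))))
        (sym (sumF-xor (f zero) _))

sumF-select : ∀ {n} (v : Fin n) (f : Vect n) → sumF (λ i → basis v i ∧ f i) ≡ f v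
sumF-select {suc n} zero    f =
  trans (cong (f zero xor_) (sumF-false {n})) (xor-identityʳ (f zero))
sumF-select {suc n} (suc v) f =
  trans (sumF-cong (λ i → cong (_∧ f (suc i)) (basis-suc v i))) (sumF-select v (λ i → f (suc i)))

sumF-assoc : ∀ {m n} (c : Vect m) (h : Fin m → Vect n) (a : Vect n) →
  sumF (λ k → sumF (λ i → c i ∧ h i k) ∧ a k) ≡ sumF (λ i → c i ∧ sumF (λ k → h i k ∧ a k))
sumF-assoc c h a = begin
  sumF (λ k → sumF (λ i → c i ∧ h i k) ∧ a k)
    ≡⟨ sumF-cong (λ k → sym (sumF-scaleʳ (a k) (λ i → c i ∧ h i k))) ⟩
  sumF (λ k → sumF (λ i → (c i ∧ h i k) ∧ a k))
    ≡⟨ sumF-cong (λ k → sumF-cong (λ i → ∧-assoc (c i) (h i k) (a k))) ⟩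
  sumF (λ k → sumF (λ i → c i ∧ (h i k ∧ a k)))
    ≡⟨ sym (sumF-swap (λ i k → c i ∧ (h i k ∧ a k))) ⟩
  sumF (λ i → sumF (λ k → c i ∧ (h i k ∧ a k)))
    ≡⟨ sumF-cong (λ i → sumF-scaleˡ (c i) (λ k → h i k ∧ a k)) ⟩
  sumF (λ i → c i ∧ sumF (λ k → h i k ∧ a k)) ∎
  where open ≡-Reasoning

comb : ∀ {m n} → (Fin m → Vect n) → Vect m → Vect n
comb f U j = sumF (λ i → U i ∧ f i j)

module _ {m n} (f : Fin m → Vect n) where

  comb-cong : ∀ {U U'} → (∀ i → U i ≡ U' i) → ∀ j → comb f U j ≡ comb f U' j
  comb-cong U≗U' j = sumF-cong (λ i → cong (_∧ f i j) (U≗U' i))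

  comb-zero : ∀ j → comb f (λ _ → false) j ≡ false
  comb-zero j = sumF-false {m}

  comb-xor : ∀ U U' j → comb f (U +ᵥ U') j ≡ comb f U j xor comb f U' j
  comb-xor U U' j =
    trans (sumF-cong (λ i → ∧-distribʳ-xor (f i j) (U i) (U' i)))
          (sumF-xor (λ i → U i ∧ f i j) (λ i → U' i ∧ f i j))

  comb-scale : ∀ c U j → comb f (λ i → c ∧ U i) j ≡ c ∧ comb f U j
  comb-scale c U j =
    trans (sumF-cong (λ i → ∧-assoc c (U i) (f i j))) (sumF-scaleˡ c (λ i → U i ∧ f i j))

  comb-basis : ∀ t j → comb f (basis t) j ≡ f t j
  comb-basis t j = sumF-select t (λ i → f i j)

comb-assoc : ∀ {m k n} (M : Fin k → Vect n) (h : Fin m → Vect k) (c : Vect m) →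
  ∀ j → comb M (comb h c) j ≡ comb (λ i → comb M (h i)) c j
comb-assoc M h c j = sumF-assoc c h (λ k → M k j)

module Form {n} (A : Fin n → Vect n) where

  ℰ-as-comb : ∀ x y → ℰ A x y ≡ sumF (λ k → comb A x k ∧ y k)
  ℰ-as-comb x y = sym (sumF-assoc x A y)

  ℰ-congˡ : ∀ {x x'} y → (∀ i → x i ≡ x' i) → ℰ A x y ≡ ℰ A x' y
  ℰ-congˡ y x≗x' = sumF-cong (λ i → cong (_∧ _) (x≗x' i))

  ℰ-congʳ : ∀ x {y y'} → (∀ i → y i ≡ y' i) → ℰ A x y ≡ ℰ A x y'
  ℰ-congʳ x y≗y' =
    sumF-cong (λ i → cong (x i ∧_) (sumF-cong (λ j → cong (A i j ∧_) (y≗y' j))))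

  ℰ-xorˡ : ∀ x x' y → ℰ A (x +ᵥ x') y ≡ ℰ A x y xor ℰ A x' y
  ℰ-xorˡ x x' y =
    trans (sumF-cong (λ i → ∧-distribʳ-xor (ℰrow i) (x i) (x' i))) 
          (sumF-xor (λ i → x i ∧ ℰrow i) (λ i → x' i ∧ ℰrow i))
    where
    ℰrow : Fin n → Bool
    ℰrow i = sumF (λ j → A i j ∧ y j)

  ℰ-combˡ : ∀ {k} (h : Fin k → Vect n) c y → ℰ A (comb h c) y ≡ sumF (λ i → c i ∧ ℰ A (h i) y)
  ℰ-combˡ h c y = sumF-assoc c h (λ k → sumF (λ j → A k j ∧ y j))

  ℰ-basisʳ : ∀ x j → ℰ A x (basis j) ≡ comb A x j
  ℰ-basisʳ x j =
    trans (ℰ-as-comb x (basis j))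
          (trans (sumF-cong (λ k → ∧-comm (comb A x k) (basis j k))) (sumF-select j (comb A x)))

  ℰ-orthogonal : ∀ x y → (∀ k → comb A x k ∧ y k ≡ false) → ℰ A x y ≡ false
  ℰ-orthogonal x y h = trans (ℰ-as-comb x y) (sumF-zero h)

module SymmetricForm {n} (A : Fin n → Vect n) (A-sym : ∀ i j → A i j ≡ A j i) where

  open Form A public

  ℰ-sym : ∀ x y → ℰ A x y ≡ ℰ A y x
  ℰ-sym x y = trans (ℰ-as-comb x y) (sumF-cong column)
    where
    column : ∀ j → comb A x j ∧ y j ≡ y j ∧ sumF (λ i → A j i ∧ x i)
    column j = trans (∧-comm (comb A x j) (y j)) (cong (y j ∧_)
      (sumF-cong (λ i → trans (∧-comm (x i) (A i j)) (cong (_∧ x i) (A-sym i j)))))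

  ℰ-xorʳ : ∀ x y y' → ℰ A x (y +ᵥ y') ≡ ℰ A x y xor ℰ A x y'
  ℰ-xorʳ x y y' =
    trans (ℰ-sym x _) (trans (ℰ-xorˡ y y' x) (cong₂ _xor_ (ℰ-sym y x) (ℰ-sym y' x)))

  ℰ-combʳ : ∀ {k} x (h : Fin k → Vect n) c → ℰ A x (comb h c) ≡ sumF (λ i → c i ∧ ℰ A x (h i))
  ℰ-combʳ x h c =
    trans (ℰ-sym x _) (trans (ℰ-combˡ h c x) (sumF-cong (λ i → cong (c i ∧_) (ℰ-sym (h i) x))))

_⊆_ : ∀ {n} → Vect n → Vect n → Set
U ⊆ T = ∀ i → U i ≡ true → T i ≡ true

_∪_ : ∀ {n} → Vect n → Vect n → Vect n
(U ∪ T) i = U i ∨ T i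

_─_ : ∀ {n} → Vect n → Fin n → Vect n
(T ─ v) i = T i ∧ not (basis v i)

─-⊆ : ∀ {n} (T : Vect n) v → (T ─ v) ⊆ T
─-⊆ T v i p = proj₁ (∧-true⁻ p)

─-self : ∀ {n} (T : Vect n) v → (T ─ v) v ≡ false
─-self T v = trans (cong (λ b → T v ∧ not b) (basis-refl v)) (∧-zeroʳ (T v))

─-absent : ∀ {n} (T : Vect n) {v} → T v ≡ false → ∀ i → (T ─ v) i ≡ T i
─-absent T {v} Tv i with v ≟ i
... | yes refl = trans (∧-zeroʳ (T v)) (sym Tv)
... | no _     = ∧-identityʳ (T i)

─-⊆-∪ : ∀ {n} {U T : Vect n} {v} → U ⊆ (T ∪ basis v) → (U ─ v) ⊆ T
─-⊆-∪ {U = U} {T} {v} U⊆T+v i p with v ≟ i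
... | yes refl = ⊥-elim (false≢true (trans (sym (∧-zeroʳ (U v))) p))
... | no v≢i   = trans (sym (trans (cong (T i ∨_) (basis-false v≢i)) (∨-identityʳ (T i))))
                       (U⊆T+v i (trans (sym (∧-identityʳ (U i))) p))

─-split : ∀ {n} (T : Vect n) {v} → T v ≡ true → ∀ i → T i ≡ basis v i xor (T ─ v) i
─-split T {v} Tv i with v ≟ i
... | yes refl rewrite Tv = refl
... | no _     = sym (∧-identityʳ (T i))

bit : Bool → ℕ
bit true  = 1
bit false = 0

card : ∀ {n} → Vect n → ℕ
card {zero}  _ = 0
card {suc n} f = bit (f zero) + card (λ i → f (suc i))

card-cong : ∀ {n} {f g : Vect n} → (∀ i → f i ≡ g i) → card f ≡ card g
card-cong {zero}  _ = refl
card-cong {suc n} h = cong₂ _+_ (cong bit (h zero)) (card-cong (λ i → h (suc i)))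

card-lookup : ∀ {n} (T : Subset n) → ∣ T ∣ ≡ card (lookup T)
card-lookup []          = refl
card-lookup (true ∷ T)  = cong suc (card-lookup T)
card-lookup (false ∷ T) = card-lookup T

card-tabulate : ∀ {n} (f : Vect n) → ∣ tabulate f ∣ ≡ card f
card-tabulate f = trans (card-lookup (tabulate f)) (card-cong (lookup∘tabulate f))

card-empty : ∀ {n} {f : Vect n} → (∀ i → f i ≡ false) → card f ≡ 0
card-empty {zero}  _ = refl
card-empty {suc n} h = cong₂ _+_ (cong bit (h zero)) (card-empty (λ i → h (suc i)))

card-empty⁻ : ∀ {n} (f : Vect n) → card f ≡ 0 → ∀ i → f i ≡ false
card-empty⁻ {suc n} f |f| zero    = bit-zero (f zero) (m+n≡0⇒m≡0 (bit (f zero)) |f|)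
  where
  bit-zero : ∀ b → bit b ≡ 0 → b ≡ false
  bit-zero false _ = refl
card-empty⁻ {suc n} f |f| (suc i) = card-empty⁻ (λ i → f (suc i)) (m+n≡0⇒n≡0 (bit (f zero)) |f|) i

card-nonempty : ∀ {n} (f : Vect n) {k} → card f ≡ suc k → Σ (Fin n) λ i → f i ≡ true
card-nonempty {suc n} f |f| with f zero in f₀
... | true  = zero , f₀
... | false = let (i , fi) = card-nonempty (λ i → f (suc i)) |f| in suc i , fi

card-basis : ∀ {n} (v : Fin n) → card (basis v) ≡ 1
card-basis {suc n} zero    = cong suc (card-empty {n} (λ _ → refl))
card-basis {suc n} (suc v) = trans (card-cong (basis-suc v)) (card-basis v)

card-union : ∀ {n} (f g : Vect n) → (∀ i → f i ∧ g i ≡ false) →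
  card (f ∪ g) ≡ card f + card g
card-union {zero}  _ _ _ = refl
card-union {suc n} f g disjoint =
  trans (cong₂ _+_ (bit-∨ (f zero) (g zero) (disjoint zero))
                   (card-union (λ i → f (suc i)) (λ i → g (suc i)) (λ i → disjoint (suc i))))
        (+-interchange (bit (f zero)) (bit (g zero)) _ _)
  where
  bit-∨ : ∀ a b → a ∧ b ≡ false → bit (a ∨ b) ≡ bit a + bit b
  bit-∨ false false _ = refl
  bit-∨ false true  _ = refl
  bit-∨ true  false _ = refl

card-remove : ∀ {n} (T : Vect n) {v} → T v ≡ true → card T ≡ suc (card (T ─ v))
card-remove T {v} Tv = begin
  card T                      ≡⟨ card-cong (λ i → trans (─-split T Tv i) (xor-disjoint i)) ⟩
  card (basis v ∪ (T ─ v))    ≡⟨ card-union (basis v) (T ─ v) disjoint ⟩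
  card (basis v) + card (T ─ v) ≡⟨ cong (_+ card (T ─ v)) (card-basis v) ⟩
  suc (card (T ─ v))          ∎
  where
  open ≡-Reasoning
  disjoint : ∀ i → basis v i ∧ (T ─ v) i ≡ false
  disjoint i with v ≟ i
  ... | yes refl = ∧-zeroʳ (T v)
  ... | no _     = refl
  xor-disjoint : ∀ i → basis v i xor (T ─ v) i ≡ basis v i ∨ (T ─ v) i
  xor-disjoint i with v ≟ i
  ... | yes refl = cong not (∧-zeroʳ (T v))
  ... | no _     = refl

card-─ : ∀ {n} (T : Vect n) {v m} → T v ≡ true → card T ≡ suc m → card (T ─ v) ≡ m
card-─ T Tv |T| = suc-injective (trans (sym (card-remove T Tv)) |T|)

card-add : ∀ {n} (T : Vect n) {v} → T v ≡ false → card (T ∪ basis v) ≡ suc (card T)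
card-add T {v} Tv = begin
  card (T ∪ basis v)        ≡⟨ card-union T (basis v) disjoint ⟩
  card T + card (basis v)   ≡⟨ cong (card T +_) (card-basis v) ⟩
  card T + 1                ≡⟨ +-comm (card T) 1 ⟩
  suc (card T)              ∎
  where
  open ≡-Reasoning
  disjoint : ∀ i → T i ∧ basis v i ≡ false
  disjoint i with v ≟ i
  ... | yes refl = cong (_∧ true) Tv
  ... | no _     = ∧-zeroʳ (T i)

-- Decoding the enumerative definition of rank into linear algebra

anyF-false⁻ : ∀ {n} (f : Vect n) → anyF f ≡ false → ∀ i → f i ≡ false
anyF-false⁻ {suc n} f none zero    = proj₁ (∨-false⁻ none)
anyF-false⁻ {suc n} f none (suc i) = anyF-false⁻ (λ i → f (suc i)) (proj₂ (∨-false⁻ {f zero} none)) i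

anyF-false⁺ : ∀ {n} (f : Vect n) → (∀ i → f i ≡ false) → anyF f ≡ false
anyF-false⁺ {zero}  _ _    = refl
anyF-false⁺ {suc n} f none = cong₂ _∨_ (none zero) (anyF-false⁺ (λ i → f (suc i)) (λ i → none (suc i)))

anyF-true⁻ : ∀ {n} (f : Vect n) → anyF f ≡ true → Σ (Fin n) λ i → f i ≡ true
anyF-true⁻ {suc n} f some with f zero in f₀
... | true  = zero , f₀
... | false = let (i , fi) = anyF-true⁻ (λ i → f (suc i)) some in suc i , fi

anyL : ∀ {A : Set} → (A → Bool) → List A → Bool
anyL p = foldr (λ x b → p x ∨ b) false

anyL-false⁻ : ∀ {A : Set} (p : A → Bool) {xs x} → anyL p xs ≡ false → x ∈ xs → p x ≡ false
anyL-false⁻ p none (here refl) = proj₁ (∨-false⁻ none)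
anyL-false⁻ p {y ∷ _} none (there x∈xs) = anyL-false⁻ p (proj₂ (∨-false⁻ {p y} none)) x∈xs

anyL-false⁺ : ∀ {A : Set} (p : A → Bool) xs → (∀ x → p x ≡ false) → anyL p xs ≡ false
anyL-false⁺ p []       _    = refl
anyL-false⁺ p (x ∷ xs) none = cong₂ _∨_ (none x) (anyL-false⁺ p xs none)

anyL-true⁻ : ∀ {A : Set} (p : A → Bool) xs → anyL p xs ≡ true → Σ A λ x → p x ≡ true
anyL-true⁻ p (x ∷ xs) some with p x in px
... | true  = x , px
... | false = anyL-true⁻ p xs some

∈-subsets : ∀ {n} (U : Subset n) → U ∈ subsets n
∈-subsets []                = here refl
∈-subsets {suc n} (true ∷ U)  = ∈-++⁺ˡ (∈-map⁺ (true ∷_) (∈-subsets U))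
∈-subsets {suc n} (false ∷ U) = ∈-++⁺ʳ (map (true ∷_) (subsets n)) (∈-map⁺ (false ∷_) (∈-subsets U))

⊆ᵇ-sound : ∀ {n} (U T : Subset n) → U ⊆ᵇ T ≡ true → lookup U ⊆ lookup T
⊆ᵇ-sound U T U⊆T i Ui = implies (lookup U i) (lookup T i) Ui
  (anyF-false⁻ (λ i → not (not (lookup U i) ∨ lookup T i)) (not-true⁻ U⊆T) i)
  where
  implies : ∀ a b → a ≡ true → not (not a ∨ b) ≡ false → b ≡ true
  implies true true _ _ = refl

⊆ᵇ-complete : ∀ {n} (U T : Subset n) → lookup U ⊆ lookup T → U ⊆ᵇ T ≡ true
⊆ᵇ-complete U T U⊆T = cong not (anyF-false⁺ _ (λ i → implies (lookup U i) (lookup T i) (U⊆T i)))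
  where
  implies : ∀ a b → (a ≡ true → b ≡ true) → not (not a ∨ b) ≡ false
  implies false b _ = refl
  implies true  b h rewrite h refl = refl

Independent : ∀ {m n} → (Fin m → Vect n) → Vect n → Vect m → Set
Independent {m} f S T =
  ∀ (U : Vect m) → U ⊆ T → (∀ j → S j ∧ comb f U j ≡ false) → ∀ i → U i ≡ false

Dependent : ∀ {m n} → (Fin m → Vect n) → Vect n → Vect m → Set
Dependent {m} f S T = Σ (Vect m) λ U → U ⊆ T × (Σ (Fin m) λ i → U i ≡ true) ×
  (∀ j → S j ∧ comb f U j ≡ false)

Independent-cong : ∀ {m n} {f : Fin m → Vect n} {S T T'} → (∀ i → T i ≡ T' i) →
  Independent f S T → Independent f S T'
Independent-cong T≗T' indep U U⊆T' = indep U (λ i Ui → trans (T≗T' i) (U⊆T' i Ui))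

Independent-columns : ∀ {m n} {f : Fin m → Vect n} {S S' T} → (∀ j → S j ≡ S' j) →
  Independent f S T → Independent f S' T
Independent-columns S≗S' indep U U⊆T vanishes =
  indep U U⊆T (λ j → trans (cong (_∧ _) (S≗S' j)) (vanishes j))

Dependent-cong : ∀ {m n} {f : Fin m → Vect n} {S T T'} → (∀ i → T i ≡ T' i) →
  Dependent f S T → Dependent f S T'
Dependent-cong T≗T' (U , U⊆T , nonzero , vanishes) =
  U , (λ i Ui → trans (sym (T≗T' i)) (U⊆T i Ui)) , nonzero , vanishes

module _ {n} (M : Fin n → Vect n) (S : Subset n) where

  -- the summand of independent M S T testing whether U is a dependency among the rows T
  dependency-test : Subset n → Subset n → Bool
  dependency-test T U = (U ⊆ᵇ T) ∧ nonempty U ∧ not (anyF (rowSum M S U))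

  independent-complete : ∀ T → Independent M (lookup S) (lookup T) → independent M S T ≡ true
  independent-complete T indep = cong not (anyL-false⁺ (dependency-test T) (subsets n) trivial)
    where
    conclude : ∀ a b c → (a ≡ true → c ≡ false → b ≡ false) → a ∧ b ∧ not c ≡ false
    conclude false b c _ = refl
    conclude true  b true  _ = ∧-zeroʳ b
    conclude true  b false h rewrite h refl refl = refl
    trivial : ∀ U → dependency-test T U ≡ false
    trivial U = conclude _ _ _ λ U⊆T vanishes → anyF-false⁺ (lookup U)
      (indep (lookup U) (⊆ᵇ-sound U T U⊆T) (anyF-false⁻ (rowSum M S U) vanishes))

  independent-sound : ∀ T → independent M S T ≡ true → Independent M (lookup S) (lookup T)
  independent-sound T indep U U⊆T vanishes i = trans (sym (lookup∘tabulate U i))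
    (anyF-false⁻ (lookup U') (nonzero-false
      (anyL-false⁻ (dependency-test T) (not-true⁻ indep) (∈-subsets U'))) i)
    where
    U' = tabulate U
    U'⊆T : U' ⊆ᵇ T ≡ true
    U'⊆T = ⊆ᵇ-complete U' T λ i p → U⊆T i (trans (sym (lookup∘tabulate U i)) p)
    U'-vanishes : anyF (rowSum M S U') ≡ false
    U'-vanishes = anyF-false⁺ _ λ j →
      trans (cong (lookup S j ∧_) (comb-cong M (lookup∘tabulate U) j)) (vanishes j)
    extract : ∀ a b c → a ∧ b ∧ not c ≡ false → a ≡ true → c ≡ false → b ≡ false
    extract true false false _ _ _ = refl
    nonzero-false : dependency-test T U' ≡ false → nonempty U' ≡ false
    nonzero-false p = extract _ _ _ p U'⊆T U'-vanishes

  dependent-witness : ∀ T → independent M S T ≡ false → Dependent M (lookup S) (lookup T)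
  dependent-witness T dep =
    lookup U , ⊆ᵇ-sound U T (proj₁ parts) , anyF-true⁻ (lookup U) (proj₁ nonzero-vanishing) ,
    anyF-false⁻ (rowSum M S U) (not-true⁻ (proj₂ nonzero-vanishing))
    where
    found = anyL-true⁻ (dependency-test T) (subsets n) (not-false⁻ dep)
    U = proj₁ found
    parts = ∧-true⁻ (proj₂ found)
    nonzero-vanishing = ∧-true⁻ {nonempty U} (proj₂ parts)

  -- independence is decidable, by the enumeration in the definition of rank
  independence? : ∀ (T : Vect n) → Independent M (lookup S) T ⊎ Dependent M (lookup S) T
  independence? T with independent M S (tabulate T) in indep
  ... | true  = inj₁ (Independent-cong (lookup∘tabulate T) (independent-sound (tabulate T) indep))
  ... | false = inj₂ (Dependent-cong (lookup∘tabulate T) (dependent-witness (tabulate T) indep))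

module _ {n} (M : Fin n → Vect n) (S : Subset n) where

  candidate : Subset n → Bool
  candidate T = (T ⊆ᵇ S) ∧ independent M S T

  largest : List (Subset n) → ℕ
  largest = foldr (λ T r → (if candidate T then ∣ T ∣ else 0) ⊔ r) 0

  largest-bound : ∀ {Ts T} → T ∈ Ts → candidate T ≡ true → ∣ T ∣ ≤ largest Ts
  largest-bound (here refl) ok rewrite ok = m≤m⊔n _ _
  largest-bound (there T∈Ts) ok = ≤-trans (largest-bound T∈Ts ok) (m≤n⊔m _ _)

  largest-attained : ∀ Ts →
    largest Ts ≡ 0 ⊎ Σ (Subset n) λ T → candidate T ≡ true × ∣ T ∣ ≡ largest Ts
  largest-attained []       = inj₁ refl
  largest-attained (T ∷ Ts) with candidate T in ok
  ... | false = largest-attained Ts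
  ... | true with ⊔-sel ∣ T ∣ (largest Ts)
  ...   | inj₁ T-wins = inj₂ (T , ok , sym T-wins)
  ...   | inj₂ Ts-win with largest-attained Ts
  ...     | inj₁ zero-size        = inj₁ (trans Ts-win zero-size)
  ...     | inj₂ (T' , ok' , |T'|) = inj₂ (T' , ok' , trans |T'| (sym Ts-win))

  rank-bound : ∀ (T : Vect n) → T ⊆ lookup S → Independent M (lookup S) T → card T ≤ rankOn M S
  rank-bound T T⊆S indep = subst (_≤ rankOn M S) (card-tabulate T)
    (largest-bound (∈-subsets (tabulate T)) (cong₂ _∧_ (⊆ᵇ-complete T' S T'⊆S)
      (independent-complete M S T' λ U U⊆T' →
        indep U λ i Ui → trans (sym (lookup∘tabulate T i)) (U⊆T' i Ui))))
    where
    T' = tabulate T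
    T'⊆S : lookup T' ⊆ lookup S
    T'⊆S i p = T⊆S i (trans (sym (lookup∘tabulate T i)) p)

record RowBasis {n} (M : Fin n → Vect n) (S : Subset n) : Set where
  field
    rows       : Vect n
    rows⊆S     : rows ⊆ lookup S
    rows-indep : Independent M (lookup S) rows
    rows-card  : card rows ≡ rankOn M S

rowBasis : ∀ {n} (M : Fin n → Vect n) (S : Subset n) → RowBasis M S
rowBasis {n} M S with largest-attained M S (subsets n)
... | inj₁ rank≡0 = record
  { rows       = λ _ → false
  ; rows⊆S     = λ i ()
  ; rows-indep = λ U U⊆∅ _ i → ¬-not (λ Ui → false≢true (U⊆∅ i Ui))
  ; rows-card  = trans (card-empty {n} (λ _ → refl)) (sym rank≡0)
  }
... | inj₂ (T , ok , |T|) = record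
  { rows       = lookup T
  ; rows⊆S     = ⊆ᵇ-sound T S (proj₁ (∧-true⁻ ok))
  ; rows-indep = independent-sound M S T (proj₂ (∧-true⁻ ok))
  ; rows-card  = trans (sym (card-lookup T)) |T|
  }

-- a row of M[S,S] outside a row basis is a combination of the basis rows:
-- T ∪ {v} is too large to be independent, and a dependency must involve v
basis-spans : ∀ {n} {M : Fin n → Vect n} {S} (B : RowBasis M S) → let open RowBasis B in
  ∀ v → lookup S v ≡ true → rows v ≡ false →
  Σ (Vect n) λ U → U ⊆ rows × (∀ j → lookup S j ∧ (M v j xor comb M U j) ≡ false)
basis-spans {n} {M} {S} B v v∈S v∉T with independence? M S (rows ∪ basis v)
  where open RowBasis B
... | inj₁ indep = ⊥-elim (n≮n (rankOn M S) (subst (_≤ rankOn M S) |T+v| (rank-bound M S _ T+v⊆S indep)))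
  where
  open RowBasis B
  |T+v| : card (rows ∪ basis v) ≡ suc (rankOn M S)
  |T+v| = trans (card-add rows v∉T) (cong suc rows-card)
  T+v⊆S : (rows ∪ basis v) ⊆ lookup S
  T+v⊆S i p with ∨-true⁻ {rows i} p
  ... | inj₁ Ti = rows⊆S i Ti
  ... | inj₂ v≡i rewrite basis-true v≡i = v∈S
... | inj₂ (U , U⊆T+v , (i , Ui) , vanishes) = U ─ v , ─-⊆-∪ U⊆T+v , relation
  where
  open RowBasis B
  Uv : U v ≡ true
  Uv with U v in U-v
  ... | true  = refl
  ... | false = ⊥-elim (false≢true (trans (sym (rows-indep U U⊆T vanishes i)) Ui))
    where
    U⊆T : U ⊆ rows
    U⊆T k Uk = ─-⊆-∪ U⊆T+v k (trans (─-absent U U-v k) Uk)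
  relation : ∀ j → lookup S j ∧ (M v j xor comb M (U ─ v) j) ≡ false
  relation j = trans (cong (lookup S j ∧_) U-as-row) (vanishes j)
    where
    U-as-row : M v j xor comb M (U ─ v) j ≡ comb M U j
    U-as-row = begin
      M v j xor comb M (U ─ v) j                ≡⟨ cong (_xor comb M (U ─ v) j) (sym (comb-basis M v j)) ⟩
      comb M (basis v) j xor comb M (U ─ v) j   ≡⟨ sym (comb-xor M (basis v) (U ─ v) j) ⟩
      comb M (basis v +ᵥ (U ─ v)) j             ≡⟨ sym (comb-cong M (─-split U Uv) j) ⟩
      comb M U j                                ∎
      where open ≡-Reasoning

module _ {k N} (g : Fin k → Vect N) (R : Vect k) where

  InSpanOf : Vect N → Set
  InSpanOf v = Σ (Vect k) λ V → V ⊆ R × (∀ j → v j ≡ comb g V j)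

  span-cong : ∀ {v v'} → (∀ j → v j ≡ v' j) → InSpanOf v → InSpanOf v'
  span-cong v≗v' (V , V⊆R , v≡) = V , V⊆R , λ j → trans (sym (v≗v' j)) (v≡ j)

  span-zero : InSpanOf (λ _ → false)
  span-zero = (λ _ → false) , (λ i ()) , (λ j → sym (comb-zero g j))

  span-xor : ∀ {v v'} → InSpanOf v → InSpanOf v' → InSpanOf (v +ᵥ v')
  span-xor (V , V⊆R , v≡) (V' , V'⊆R , v'≡) = V +ᵥ V' , V+V'⊆R ,
    λ j → trans (cong₂ _xor_ (v≡ j) (v'≡ j)) (sym (comb-xor g V V' j))
    where
    V+V'⊆R : (V +ᵥ V') ⊆ R
    V+V'⊆R i p with xor-true⁻ {V i} p
    ... | inj₁ Vi  = V⊆R i Vi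
    ... | inj₂ V'i = V'⊆R i V'i

  span-generator : ∀ {r} → R r ≡ true → InSpanOf (g r)
  span-generator {r} Rr = basis r , (λ i p → subst (λ x → R x ≡ true) (basis-true p) Rr) ,
    λ j → sym (comb-basis g r j)

  span-scaled : ∀ {v} b → (b ≡ true → InSpanOf v) → InSpanOf (λ j → b ∧ v j)
  span-scaled true  v∈ = v∈ refl
  span-scaled false _  = span-zero

  span-comb : ∀ {m} {h : Fin m → Vect N} {c} → (∀ i → c i ≡ true → InSpanOf (h i)) → InSpanOf (comb h c)
  span-comb {zero}          _     = span-zero
  span-comb {suc m} {c = c} h∈ = span-xor (span-scaled (c zero) (h∈ zero)) (span-comb (λ i → h∈ (suc i)))

-- The Steinitz exchange lemma, by elimination of one generator at a time

-- the set of all columns: Independent f full T is plain linear independence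
full : ∀ {n} → Vect n
full _ = true

module Exchange {k N} (g : Fin k → Vect N) where

  Spans : ∀ {n} → Vect k → (Fin n → Vect N) → Vect n → (Fin n → Vect k) → Set
  Spans R f T V = ∀ t → T t ≡ true → V t ⊆ R × (∀ j → f t j ≡ comb g (V t) j)

  exchange-empty : ∀ {n R f T} {V : Fin n → Vect k} →
    card R ≡ 0 → Independent f full T → Spans R f T V → card T ≡ 0
  exchange-empty {R = R} {f} {T} {V} |R| indep spans = card-empty T-empty
    where
    T-empty : ∀ t → T t ≡ false
    T-empty t = ¬-not λ Tt → false≢true (trans (sym (indep (basis t) (single Tt) (f-zero Tt) t)) (basis-refl t))
      where
      single : T t ≡ true → basis t ⊆ T
      single Tt i p = subst (λ x → T x ≡ true) (basis-true p) Tt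
      f-zero : T t ≡ true → ∀ j → comb f (basis t) j ≡ false
      f-zero Tt j = trans (comb-basis f t j) (trans (proj₂ (spans t Tt) j)
        (sumF-zero λ i → cong (_∧ g i j) (¬-not λ Vti →
          false≢true (trans (sym (card-empty⁻ R |R| i)) (proj₁ (spans t Tt) i Vti)))))

  drop-unused : ∀ {n R f T} {V : Fin n → Vect k} {r} →
    (∀ t → T t ≡ true → V t r ≡ false) → Spans R f T V → Spans (R ─ r) f T V
  drop-unused {R = R} {V = V} {r} unused spans t Tt = V⊆R─r , proj₂ (spans t Tt)
    where
    V⊆R─r : V t ⊆ (R ─ r)
    V⊆R─r i Vti with r ≟ i
    ... | yes refl = ⊥-elim (false≢true (trans (sym (unused t Tt)) Vti))
    ... | no _     = trans (∧-identityʳ (R i)) (proj₁ (spans t Tt) i Vti)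

  -- Gaussian elimination step: h'_t = h_t + c_t h_{t₀}
  pivot : ∀ {n M} → Vect n → Fin n → (Fin n → Vect M) → Fin n → Vect M
  pivot c t₀ h t j = h t j xor (c t ∧ h t₀ j)

  -- eliminating the r-coefficients with the help of f_{t₀} makes r unused
  pivot-spans : ∀ {n R f T} {V : Fin n → Vect k} {r t₀} → T t₀ ≡ true → V t₀ r ≡ true →
    Spans R f T V → let c = λ t → V t r in
    Spans (R ─ r) (pivot c t₀ f) (T ─ t₀) (pivot c t₀ V)
  pivot-spans {R = R} {f} {T} {V} {r} {t₀} Tt₀ Vt₀r spans t Tt = V'⊆R─r , f'≡
    where
    c = λ t → V t r
    t∈T = ─-⊆ T t₀ t Tt
    V'⊆R─r : pivot c t₀ V t ⊆ (R ─ r)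
    V'⊆R─r i p with r ≟ i
    ... | yes refl = ⊥-elim (false≢true (trans (sym eliminated) p))
      where
      eliminated : V t r xor (V t r ∧ V t₀ r) ≡ false
      eliminated = trans (cong (λ b → V t r xor b) (trans (cong (V t r ∧_) Vt₀r) (∧-identityʳ (V t r))))
                         (xor-same (V t r))
    ... | no _ with xor-true⁻ {V t i} p
    ...   | inj₁ Vti  = trans (∧-identityʳ (R i)) (proj₁ (spans t t∈T) i Vti)
    ...   | inj₂ cVi  = trans (∧-identityʳ (R i)) (proj₁ (spans t₀ Tt₀) i (proj₂ (∧-true⁻ cVi)))
    f'≡ : ∀ j → pivot c t₀ f t j ≡ comb g (pivot c t₀ V t) j
    f'≡ j = begin
      f t j xor (c t ∧ f t₀ j)
        ≡⟨ cong₂ _xor_ (proj₂ (spans t t∈T) j) (cong (c t ∧_) (proj₂ (spans t₀ Tt₀) j)) ⟩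
      comb g (V t) j xor (c t ∧ comb g (V t₀) j)
        ≡⟨ cong (comb g (V t) j xor_) (sym (comb-scale g (c t) (V t₀) j)) ⟩
      comb g (V t) j xor comb g (λ i → c t ∧ V t₀ i) j
        ≡⟨ sym (comb-xor g (V t) (λ i → c t ∧ V t₀ i) j) ⟩
      comb g (pivot c t₀ V t) j ∎
      where open ≡-Reasoning

  pivot-independent : ∀ {n} {f : Fin n → Vect N} {T} c {t₀} → T t₀ ≡ true →
    Independent f full T → Independent (pivot c t₀ f) full (T ─ t₀)
  pivot-independent {n} {f} {T} c {t₀} Tt₀ indep U U⊆T' vanishes i with t₀ ≟ i
  ... | yes refl = ¬-not λ Ut₀ → false≢true (trans (sym (─-self T t₀)) (U⊆T' t₀ Ut₀))
  ... | no t₀≢i  = trans (sym (U*-off t₀≢i)) (U*-zero i)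
    where
    σ = sumF (λ i → U i ∧ c i)
    -- the relation U among the f' is the relation U* among the f
    U* : Vect n
    U* = U +ᵥ (λ i → σ ∧ basis t₀ i)
    U*-off : ∀ {i} → t₀ ≢ i → U* i ≡ U i
    U*-off {i} t₀≢i = trans (cong (U i xor_) (trans (cong (σ ∧_) (basis-false t₀≢i)) (∧-zeroʳ σ)))
                            (xor-identityʳ (U i))
    U*⊆T : U* ⊆ T
    U*⊆T i p with xor-true⁻ {U i} p
    ... | inj₁ Ui  = ─-⊆ T t₀ i (U⊆T' i Ui)
    ... | inj₂ σt₀ = subst (λ x → T x ≡ true) (basis-true (proj₂ (∧-true⁻ σt₀))) Tt₀
    comb-pivot : ∀ j → comb (pivot c t₀ f) U j ≡ comb f U j xor (σ ∧ f t₀ j)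
    comb-pivot j = begin
      sumF (λ i → U i ∧ (f i j xor (c i ∧ f t₀ j)))
        ≡⟨ sumF-cong (λ i → ∧-distribˡ-xor (U i) (f i j) (c i ∧ f t₀ j)) ⟩
      sumF (λ i → (U i ∧ f i j) xor (U i ∧ (c i ∧ f t₀ j)))
        ≡⟨ sumF-xor (λ i → U i ∧ f i j) (λ i → U i ∧ (c i ∧ f t₀ j)) ⟩
      comb f U j xor sumF (λ i → U i ∧ (c i ∧ f t₀ j))
        ≡⟨ cong (comb f U j xor_) (trans (sumF-cong (λ i → sym (∧-assoc (U i) (c i) (f t₀ j))))
                                         (sumF-scaleʳ (f t₀ j) (λ i → U i ∧ c i))) ⟩
      comb f U j xor (σ ∧ f t₀ j) ∎
      where open ≡-Reasoning
    comb-U* : ∀ j → comb f U* j ≡ comb f U j xor (σ ∧ f t₀ j)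
    comb-U* j = trans (comb-xor f U (λ i → σ ∧ basis t₀ i) j)
      (cong (comb f U j xor_) (trans (comb-scale f σ (basis t₀) j) (cong (σ ∧_) (comb-basis f t₀ j))))
    U*-zero : ∀ i → U* i ≡ false
    U*-zero = indep U* U*⊆T λ j → trans (comb-U* j) (trans (sym (comb-pivot j)) (vanishes j))

  -- Induction on |R|: pick r ∈ R; if no f_t uses g_r, drop r; otherwise pivot on
  -- some f_{t₀} using it, which removes both r and t₀.
  exchange : ∀ {n} m {R f T} {V : Fin n → Vect k} →
    card R ≡ m → Independent f full T → Spans R f T V → card T ≤ m
  exchange zero |R| indep spans = ≤-reflexive (exchange-empty |R| indep spans)
  exchange (suc m) {R} {f} {T} {V} |R| indep spans with card-nonempty R |R|
  ... | r , Rr with anyF (λ t → T t ∧ V t r) in uses-r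
  ...   | false = m≤n⇒m≤1+n (exchange m (card-─ R Rr |R|) indep (drop-unused unused spans))
    where
    unused : ∀ t → T t ≡ true → V t r ≡ false
    unused t Tt = trans (sym (cong (_∧ V t r) Tt)) (anyF-false⁻ _ uses-r t)
  ...   | true = subst (_≤ suc m) (sym (card-remove T Tt₀))
                   (s≤s (exchange m (card-─ R Rr |R|) (pivot-independent c Tt₀ indep)
                                                       (pivot-spans Tt₀ Vt₀r spans)))
    where
    c = λ t → V t r
    user = anyF-true⁻ (λ t → T t ∧ V t r) uses-r
    Tt₀ = proj₁ (∧-true⁻ (proj₂ user))
    Vt₀r = proj₂ (∧-true⁻ (proj₂ user))

-- The reduction along a reducible set W, with A the adjacency matrix of G

module Reduction {n} (G : Graph n) (W : Subset n) (reducible : Reducible G W) where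

  A : Fin n → Vect n
  A = adj G

  open SymmetricForm A (adj-sym G)
  open Exchange using (Spans; exchange)

  inW : Vect n
  inW i = i ∈ᵇ W

  in∁W : ∀ i → lookup (∁ W) i ≡ not (inW i)
  in∁W i = lookup-map i not W

  -- e_i = a_i + b_i with a_i ∈ ⟨W⟩ and b_i ∈ ⟨W⟩^⊥
  a b : Fin n → Vect n
  a i = proj₁ (reducible (basis i))
  b i = proj₁ (proj₂ (reducible (basis i)))

  a-span : ∀ i → InSpan W (a i)
  a-span i = proj₁ (proj₂ (proj₂ (reducible (basis i))))

  b-perp : ∀ i → InPerp G W (b i)
  b-perp i = proj₁ (proj₂ (proj₂ (proj₂ (reducible (basis i)))))

  basis-split : ∀ i j → basis i j ≡ a i j xor b i j
  basis-split i = proj₂ (proj₂ (proj₂ (proj₂ (reducible (basis i)))))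

  b-outside : ∀ i {j} → inW j ≡ false → b i j ≡ basis i j
  b-outside i {j} j∉W = sym (trans (basis-split i j) (cong (_xor b i j) (a-span i j j∉W)))

  e+b-span : ∀ i → InSpan W (basis i +ᵥ b i)
  e+b-span i j j∉W = trans (cong (basis i j xor_) (b-outside i j∉W)) (xor-same (basis i j))

  span-perp : ∀ {s p} → InSpan W s → InPerp G W p → ℰ A s p ≡ false
  span-perp {s} {p} s∈ p⊥ = trans (ℰ-sym s p) (p⊥ s s∈)

  perp-xor : ∀ {p q} → InPerp G W p → InPerp G W q → InPerp G W (p +ᵥ q)
  perp-xor {p} {q} p⊥ q⊥ y y∈ = trans (ℰ-xorˡ p q y) (cong₂ _xor_ (p⊥ y y∈) (q⊥ y y∈))

  perp-comb : ∀ {k} (h : Fin k → Vect n) c → (∀ i → InPerp G W (h i)) → InPerp G W (comb h c)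
  perp-comb h c h⊥ y y∈ =
    trans (ℰ-combˡ h c y) (sumF-zero λ i → trans (cong (c i ∧_) (h⊥ i y y∈)) (∧-zeroʳ (c i)))

  offW : Vect n → Vect n
  offW x i = x i ∧ not (inW i)

  offW-inside : ∀ x {i} → inW i ≡ true → offW x i ≡ false
  offW-inside x {i} i∈W = trans (cong (λ w → x i ∧ not w) i∈W) (∧-zeroʳ (x i))

  offW-outside : ∀ x {i} → inW i ≡ false → offW x i ≡ x i
  offW-outside x {i} i∉W = trans (cong (λ w → x i ∧ not w) i∉W) (∧-identityʳ (x i))

  offW-∧-cong : ∀ x {i e e'} → (inW i ≡ false → e ≡ e') → offW x i ∧ e ≡ offW x i ∧ e'
  offW-∧-cong x {i} {e} {e'} h = by-cases (inW i) refl
    where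
    by-cases : ∀ w → inW i ≡ w → offW x i ∧ e ≡ offW x i ∧ e'
    by-cases true  i∈W = trans (cong (_∧ e) (offW-inside x i∈W)) (sym (cong (_∧ e') (offW-inside x i∈W)))
    by-cases false i∉W = cong (offW x i ∧_) (h i∉W)

  -- P x = Σ_{i∉W} x_i b_i is the projection of x onto ⟨W⟩^⊥ along ⟨W⟩
  P : Vect n → Vect n
  P x = comb b (offW x)

  x+Px-span : ∀ x → InSpan W (x +ᵥ P x)
  x+Px-span x j j∉W = trans (cong (x j xor_) Px≡x) (xor-same (x j))
    where
    Px≡x : P x j ≡ x j
    Px≡x = begin
      sumF (λ i → offW x i ∧ b i j)
        ≡⟨ sumF-cong (λ i → trans (cong (offW x i ∧_) (trans (b-outside i j∉W) (basis-sym i j)))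
                                  (∧-comm (offW x i) (basis j i))) ⟩
      sumF (λ i → basis j i ∧ offW x i)   ≡⟨ sumF-select j (offW x) ⟩
      offW x j                           ≡⟨ offW-outside x j∉W ⟩
      x j                                ∎
      where open ≡-Reasoning

  radical-test : ∀ {y} → InPerp G W y → (∀ i → inW i ≡ false → ℰ A y (b i) ≡ false) →
    ∀ z → ℰ A y z ≡ false
  radical-test {y} y⊥ y⊥b z = begin
    ℰ A y z                            ≡⟨ ℰ-congʳ y (λ j → sym (xor-cancelʳ (z j) (P z j))) ⟩
    ℰ A y ((z +ᵥ P z) +ᵥ P z)          ≡⟨ ℰ-xorʳ y (z +ᵥ P z) (P z) ⟩
    ℰ A y (z +ᵥ P z) xor ℰ A y (P z)   ≡⟨ cong₂ _xor_ (y⊥ _ (x+Px-span z)) (ℰ-combʳ y b (offW z)) ⟩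
    sumF (λ i → offW z i ∧ ℰ A y (b i)) ≡⟨ sumF-zero (λ i → trans (offW-∧-cong z {i} (y⊥b i))
                                                                    (∧-zeroʳ (offW z i))) ⟩
    false                              ∎
    where open ≡-Reasoning

  radical-span∩perp : ∀ {y} → InSpan W y → InPerp G W y → ∀ z → ℰ A y z ≡ false
  radical-span∩perp y∈ y⊥ = radical-test y⊥ (λ i _ → span-perp y∈ (b-perp i))

  radical-kernel : ∀ {y} → (∀ z → ℰ A y z ≡ false) → ∀ j → comb A y j ≡ false
  radical-kernel {y} y-rad j = trans (sym (ℰ-basisʳ y j)) (y-rad (basis j))

  module _ (Γ : Fin n → Vect n) (Γ-spec : IsGamma G W Γ) where

    Γ≡ℰ : ∀ {v w} → inW v ≡ false → inW w ≡ false → Γ v w ≡ ℰ A (b v) (b w)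
    Γ≡ℰ {v} {w} v∉W w∉W =
      Γ-spec v w v∉W w∉W (b v) (b w) (b-perp v) (b-perp w) (e+b-span v) (e+b-span w)

    B₀ : RowBasis A W
    B₀ = rowBasis A W

    B₁ : RowBasis Γ (∁ W)
    B₁ = rowBasis Γ (∁ W)

    open RowBasis B₀ using () renaming (rows to T₀; rows⊆S to T₀-inside)
    open RowBasis B₁ using () renaming (rows to T₁)

    T₁-outside : ∀ {i} → T₁ i ≡ true → inW i ≡ false
    T₁-outside {i} t₁ = not-true⁻ (trans (sym (in∁W i)) (RowBasis.rows⊆S B₁ i t₁))

    R : Vect n
    R = T₀ ∪ T₁

    card-R : card R ≡ rankG G W + rankOn Γ (∁ W)
    card-R = trans (card-union T₀ T₁ disjoint) (cong₂ _+_ (RowBasis.rows-card B₀) (RowBasis.rows-card B₁))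
      where
      disjoint : ∀ i → T₀ i ∧ T₁ i ≡ false
      disjoint i = ¬-not λ both →
        false≢true (trans (sym (T₁-outside (proj₂ (∧-true⁻ both))))
                          (T₀-inside i (proj₁ (∧-true⁻ both))))

    Γ-relation : ∀ U → (∀ j → comb A U j ≡ false) →
      ∀ w → inW w ≡ false → comb Γ (offW U) w ≡ false
    Γ-relation U U-rel w w∉W = begin
      sumF (λ i → offW U i ∧ Γ i w)
        ≡⟨ sumF-cong (λ i → offW-∧-cong U {i} (λ i∉W → Γ≡ℰ i∉W w∉W)) ⟩
      sumF (λ i → offW U i ∧ ℰ A (b i) (b w))
        ≡⟨ sym (ℰ-combˡ b (offW U) (b w)) ⟩
      ℰ A (P U) (b w)
        ≡⟨ ℰ-congˡ (b w) (λ j → sym (xor-cancelˡ (U j) (P U j))) ⟩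
      ℰ A (U +ᵥ (U +ᵥ P U)) (b w)
        ≡⟨ ℰ-xorˡ U (U +ᵥ P U) (b w) ⟩
      ℰ A U (b w) xor ℰ A (U +ᵥ P U) (b w)
        ≡⟨ cong₂ _xor_ (ℰ-orthogonal U (b w) (λ k → cong (_∧ b w k) (U-rel k)))
                       (span-perp (x+Px-span U) (b-perp w)) ⟩
      false                                     ∎
      where open ≡-Reasoning

    R-independent : Independent A full R
    R-independent U U⊆R U-rel = RowBasis.rows-indep B₀ U U⊆T₀ inside-relation
      where
      offW-U⊆T₁ : offW U ⊆ T₁
      offW-U⊆T₁ i p with ∨-true⁻ {T₀ i} (U⊆R i (proj₁ (∧-true⁻ p)))
      ... | inj₁ t₀ = ⊥-elim (false≢true (trans (sym (cong not (T₀-inside i t₀)))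
                                               (proj₂ (∧-true⁻ p))))
      ... | inj₂ t₁ = t₁
      offW-U-zero : ∀ i → offW U i ≡ false
      offW-U-zero = RowBasis.rows-indep B₁ (offW U) offW-U⊆T₁ Γ-vanishes
        where
        Γ-vanishes : ∀ w → lookup (∁ W) w ∧ comb Γ (offW U) w ≡ false
        Γ-vanishes w with inW w in w∈W
        ... | true  = cong (_∧ comb Γ (offW U) w) (trans (in∁W w) (cong not w∈W))
        ... | false = trans (cong (lookup (∁ W) w ∧_) (Γ-relation U U-rel w w∈W)) (∧-zeroʳ _)
      U⊆T₀ : U ⊆ T₀
      U⊆T₀ i Ui with ∨-true⁻ {T₀ i} (U⊆R i Ui)
      ... | inj₁ t₀ = t₀
      ... | inj₂ t₁ = ⊥-elim (false≢true (trans (sym (offW-U-zero i))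
                                               (trans (offW-outside U (T₁-outside t₁)) Ui)))
      inside-relation : ∀ j → inW j ∧ comb A U j ≡ false
      inside-relation j = trans (cong (inW j ∧_) (U-rel j)) (∧-zeroʳ (inW j))

    lower : rankG G W + rankOn Γ (∁ W) ≤ rank G
    lower = subst (_≤ rank G) card-R
      (rank-bound A ⊤ R (λ i _ → lookup-replicate i true)
        (Independent-columns (λ j → sym (lookup-replicate j true)) R-independent))

    -- generators: the rows A_u for u ∈ W and the vectors A b_u for u ∉ W
    gen : Fin n → Vect n
    gen u = if inW u then A u else comb A (b u)

    Spanned : Vect n → Set
    Spanned = InSpanOf gen R

    generator-inside : ∀ {u} → T₀ u ≡ true → Spanned (A u)
    generator-inside {u} t₀ = span-cong gen R gen≡ (span-generator gen R (cong (_∨ T₁ u) t₀))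
      where
      gen≡ : ∀ j → gen u j ≡ A u j
      gen≡ j rewrite T₀-inside u t₀ = refl

    generator-outside : ∀ {u} → T₁ u ≡ true → Spanned (comb A (b u))
    generator-outside {u} t₁ =
      span-cong gen R gen≡ (span-generator gen R (trans (cong (T₀ u ∨_) t₁) (∨-zeroʳ (T₀ u))))
      where
      gen≡ : ∀ j → gen u j ≡ comb A (b u) j
      gen≡ j rewrite T₁-outside t₁ = refl

    row-spanned : ∀ {w} → inW w ≡ true → Spanned (A w)
    row-spanned {w} w∈W with T₀ w in t₀
    ... | true  = generator-inside t₀
    ... | false = span-cong gen R Aw≡ (span-comb gen R λ i Ui → generator-inside (U⊆T₀ i Ui))
      where
      found = basis-spans B₀ w w∈W t₀
      U = proj₁ found
      U⊆T₀ = proj₁ (proj₂ found)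
      -- y = e_w + U lies in ⟨W⟩ ∩ ⟨W⟩^⊥, hence A y = 0
      y : Vect n
      y = basis w +ᵥ U
      Ay≡ : ∀ j → comb A y j ≡ A w j xor comb A U j
      Ay≡ j = trans (comb-xor A (basis w) U j) (cong (_xor comb A U j) (comb-basis A w j))
      y-span : InSpan W y
      y-span i i∉W = cong₂ _xor_
        (basis-false λ w≡i → false≢true (trans (sym i∉W) (subst (λ x → inW x ≡ true) w≡i w∈W)))
        (¬-not λ Ui → false≢true (trans (sym i∉W) (T₀-inside i (U⊆T₀ i Ui))))
      y-perp : InPerp G W y
      y-perp z z∈ = ℰ-orthogonal y z term
        where
        term : ∀ k → comb A y k ∧ z k ≡ false
        term k with inW k in k∈W
        ... | true  = cong (_∧ z k) (trans (Ay≡ k)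
                        (trans (sym (cong (_∧ (A w k xor comb A U k)) k∈W)) (proj₂ (proj₂ found) k)))
        ... | false = trans (cong (comb A y k ∧_) (z∈ k k∈W)) (∧-zeroʳ (comb A y k))
      Aw≡ : ∀ j → comb A U j ≡ A w j
      Aw≡ j = sym (xor-false⁻ (trans (sym (Ay≡ j))
                (radical-kernel (radical-span∩perp y-span y-perp) j)))

    b-row-spanned : ∀ {v} → inW v ≡ false → Spanned (comb A (b v))
    b-row-spanned {v} v∉W with T₁ v in t₁
    ... | true  = generator-outside t₁
    ... | false = span-cong gen R Abv≡
        (span-cong gen R (λ j → sym (comb-assoc A b U j))
          (span-comb gen R λ i Ui → generator-outside (U⊆T₁ i Ui)))
      where
      found = basis-spans B₁ v (trans (in∁W v) (cong not v∉W)) t₁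
      U = proj₁ found
      U⊆T₁ = proj₁ (proj₂ found)
      -- y = b_v + Σ U_i b_i lies in ⟨W⟩^⊥ and is orthogonal to the b_i, i ∉ W; hence A y = 0
      y : Vect n
      y = b v +ᵥ comb b U
      y⊥b : ∀ i → inW i ≡ false → ℰ A y (b i) ≡ false
      y⊥b i i∉W = begin
        ℰ A y (b i)                                ≡⟨ ℰ-xorˡ (b v) (comb b U) (b i) ⟩
        ℰ A (b v) (b i) xor ℰ A (comb b U) (b i)   ≡⟨ cong₂ _xor_ (sym (Γ≡ℰ v∉W i∉W))
                                                                  (trans (ℰ-combˡ b U (b i)) (sumF-cong term)) ⟩
        Γ v i xor comb Γ U i                       ≡⟨ trans (sym (cong (_∧ (Γ v i xor comb Γ U i))
                                                                       (trans (in∁W i) (cong not i∉W))))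
                                                            (proj₂ (proj₂ found) i) ⟩
        false                                      ∎
        where
        open ≡-Reasoning
        term : ∀ k → U k ∧ ℰ A (b k) (b i) ≡ U k ∧ Γ k i
        term k with U k in Uk
        ... | true  = sym (Γ≡ℰ (T₁-outside (U⊆T₁ k Uk)) i∉W)
        ... | false = refl
      Abv≡ : ∀ j → comb A (comb b U) j ≡ comb A (b v) j
      Abv≡ j = sym (xor-false⁻ (trans (sym (comb-xor A (b v) (comb b U) j))
                 (radical-kernel (radical-test (perp-xor (b-perp v) (perp-comb b U b-perp)) y⊥b) j)))

    -- every vector A x is spanned, splitting x = (x + P x) + P x
    all-spanned : ∀ x → Spanned (comb A x)
    all-spanned x = span-cong gen R recombine (span-xor gen R inside-part outside-part)
      where
      inside-part : Spanned (comb A (x +ᵥ P x))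
      inside-part = span-comb gen R λ i p → row-spanned (contraposeᵇ (x+Px-span x i) p)
      outside-part : Spanned (comb A (P x))
      outside-part = span-cong gen R (λ j → sym (comb-assoc A b (offW x) j))
        (span-comb gen R {h = λ i → comb A (b i)} {c = offW x} λ i p →
          b-row-spanned (not-true⁻ (proj₂ (∧-true⁻ {x i} p))))
      recombine : ∀ j → comb A (x +ᵥ P x) j xor comb A (P x) j ≡ comb A x j
      recombine j = trans (sym (comb-xor A (x +ᵥ P x) (P x) j))
                          (comb-cong A (λ i → xor-cancelʳ (x i) (P x i)) j)

    -- upper bound: a row basis of A is spanned by the |R| generators
    upper : rank G ≤ rankG G W + rankOn Γ (∁ W)
    upper = begin
      rank G          ≡⟨ sym rows-card ⟩
      card rows       ≤⟨ exchange gen (card R) refl rows-independent spans ⟩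
      card R          ≡⟨ card-R ⟩
      rankG G W + rankOn Γ (∁ W) ∎
      where
      open ≤-Reasoning
      open RowBasis (rowBasis A ⊤)
      rows-independent : Independent A full rows
      rows-independent = Independent-columns (λ j → lookup-replicate j true) rows-indep
      spans : Spans gen R A rows (λ u → proj₁ (all-spanned (basis u)))
      spans t _ = proj₁ (proj₂ (all-spanned (basis t))) ,
        λ j → trans (sym (comb-basis A t j)) (proj₂ (proj₂ (all-spanned (basis t))) j)

mainTheorem6 : ∀ {n : ℕ} (G : Graph n) (W : Subset n) → Reducible G W →
    ∀ (Γ : Fin n → Fin n → Bool) → IsGamma G W Γ →
    rank G ≡ rankG G W + rankOn Γ (∁ W)
mainTheorem6 G W reducible Γ Γ-spec = ≤-antisym (upper Γ Γ-spec) (lower Γ Γ-spec)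
  where open Reduction G W reducible
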